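{- Suppose $\mathcal{C}$ has an initial object $0$. Let $(T,\tau)$ be the companion of a functor $B\colon\mathcal{C}\to\mathcal{C}$ and let $(T,\eta,\mu)$ be the unique monad structure on $T$ for which $\tau$ is a distributive law of the monad over $B$. Then the $B$-coalgebra $(T0,\ \tau_0\circ T!_{B0})$ (where $!_{B0}\colon 0\to B0$ is the unique map) is a final $B$-coalgebra, and the algebra induced on it by $\tau$ is $\mu_0\colon TT0\to T0$.
   Context: The category $\mathrm{DL}(B)$ has as objects pairs $(F,\lambda)$ with $F\colon\mathcal{C}\to\mathcal{C}$ a functor and $\lambda\colon FB\Rightarrow BF$ natural; morphisms $(F,\lambda)\to(G,\rho)$ are natural $\kappa\colon F\Rightarrow G$ with $\rho\circ\kappa B=B\kappa\circ\lambda$. The companion is a final object of $\mathrm{DL}(B)$. There exist unique $\eta\colon\mathrm{Id}\Rightarrow T$, $\mu\colon TT\Rightarrow T$ making $(T,\eta,\mu)$ a monad with $B\eta=\tau\circ\eta B$ and $\tau\circ\mu B=B\mu\circ\tau T\circ T\tau$. Given a final coalgebra $(Z,\zeta)$ and a natural $\lambda\colon FB\Rightarrow BF$, the algebra induced by $\lambda$ is the unique $\alpha\colon FZ\to Z$ with $\zeta\circ\alpha=B\alpha\circ\lambda_Z\circ F\zeta$. -}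

module Defs where

open import Level using (Level; _⊔_; suc)
open import Data.Product using (Σ; _×_; _,_)
open import Relation.Binary using (IsEquivalence)

record Category (o ℓ e : Level) : Set (suc (o ⊔ ℓ ⊔ e)) where
  infixr 9 _∘_
  infix  4 _≈_
  field
    Obj   : Set o
    Hom   : Obj → Obj → Set ℓ
    _≈_   : ∀ {A B} → Hom A B → Hom A B → Set e
    id    : ∀ {A} → Hom A A
    _∘_   : ∀ {A B C} → Hom B C → Hom A B → Hom A C
    ≈-equiv    : ∀ {A B} → IsEquivalence (_≈_ {A} {B})
    assoc      : ∀ {A B C D} {f : Hom A B} {g : Hom B C} {h : Hom C D} →
                 (h ∘ g) ∘ f ≈ h ∘ (g ∘ f)
    identityˡ  : ∀ {A B} {f : Hom A B} → id ∘ f ≈ f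
    identityʳ  : ∀ {A B} {f : Hom A B} → f ∘ id ≈ f
    ∘-resp-≈   : ∀ {A B C} {f h : Hom B C} {g i : Hom A B} →
                 f ≈ h → g ≈ i → f ∘ g ≈ h ∘ i

module _ {o ℓ e : Level} (C : Category o ℓ e) where
  open Category C

  record Endofunctor : Set (o ⊔ ℓ ⊔ e) where
    field
      F₀ : Obj → Obj
      F₁ : ∀ {A B} → Hom A B → Hom (F₀ A) (F₀ B)
      identity     : ∀ {A} → F₁ (id {A}) ≈ id
      homomorphism : ∀ {A B C} {f : Hom A B} {g : Hom B C} →
                     F₁ (g ∘ f) ≈ F₁ g ∘ F₁ f
      F-resp-≈     : ∀ {A B} {f g : Hom A B} → f ≈ g → F₁ f ≈ F₁ g

  open Endofunctor

  IdF : Endofunctor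
  IdF = record
    { F₀ = λ X → X ; F₁ = λ f → f
    ; identity = IsEquivalence.refl ≈-equiv
    ; homomorphism = IsEquivalence.refl ≈-equiv
    ; F-resp-≈ = λ p → p }

  _∘F_ : Endofunctor → Endofunctor → Endofunctor
  F ∘F G = record
    { F₀ = λ X → F₀ F (F₀ G X)
    ; F₁ = λ f → F₁ F (F₁ G f)
    ; identity = IsEquivalence.trans ≈-equiv (F-resp-≈ F (identity G)) (identity F)
    ; homomorphism = IsEquivalence.trans ≈-equiv (F-resp-≈ F (homomorphism G)) (homomorphism F)
    ; F-resp-≈ = λ p → F-resp-≈ F (F-resp-≈ G p) }

  record NatTrans (F G : Endofunctor) : Set (o ⊔ ℓ ⊔ e) where
    field
      η           : ∀ X → Hom (F₀ F X) (F₀ G X)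
      commute     : ∀ {X Y} (f : Hom X Y) → η Y ∘ F₁ F f ≈ F₁ G f ∘ η X

  open NatTrans

  -- The category DL(B) (only what is needed: objects, morphisms,
  -- finality) for a fixed endofunctor B.

  module _ (B : Endofunctor) where

    DLObj : Set (o ⊔ ℓ ⊔ e)
    DLObj = Σ Endofunctor (λ F → NatTrans (F ∘F B) (B ∘F F))

    IsDLMor : (X Y : DLObj) → NatTrans (Σ.proj₁ X) (Σ.proj₁ Y) → Set (o ⊔ e)
    IsDLMor (F , λ′) (G , ρ) κ =
      ∀ X → η ρ X ∘ η κ (F₀ B X) ≈ F₁ B (η κ X) ∘ η λ′ X

    DLMor : DLObj → DLObj → Set (o ⊔ ℓ ⊔ e)
    DLMor X Y = Σ (NatTrans (Σ.proj₁ X) (Σ.proj₁ Y)) (IsDLMor X Y)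

    -- final object of DL(B); morphisms are equal iff componentwise ≈
    IsFinalDL : DLObj → Set (o ⊔ ℓ ⊔ e)
    IsFinalDL Z =
      (∀ X → DLMor X Z) ×
      (∀ X (κ κ′ : DLMor X Z) → ∀ A → η (Σ.proj₁ κ) A ≈ η (Σ.proj₁ κ′) A)

    IsCompanion : (T : Endofunctor) → NatTrans (T ∘F B) (B ∘F T) → Set (o ⊔ ℓ ⊔ e)
    IsCompanion T τ = IsFinalDL (T , τ)

    IsCoalgMor : ∀ {X Z} → Hom X (F₀ B X) → Hom Z (F₀ B Z) → Hom X Z → Set e
    IsCoalgMor ξ ζ f = ζ ∘ f ≈ F₁ B f ∘ ξ

    IsFinalCoalgebra : (Z : Obj) → Hom Z (F₀ B Z) → Set (o ⊔ ℓ ⊔ e)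
    IsFinalCoalgebra Z ζ =
      ∀ (X : Obj) (ξ : Hom X (F₀ B X)) →
        Σ (Hom X Z) (IsCoalgMor ξ ζ) ×
        (∀ f g → IsCoalgMor ξ ζ f → IsCoalgMor ξ ζ g → f ≈ g)

    IsInducedAlgebra : (Z : Obj) (ζ : Hom Z (F₀ B Z)) (F : Endofunctor)
                       (λ′ : NatTrans (F ∘F B) (B ∘F F)) →
                       Hom (F₀ F Z) Z → Set (ℓ ⊔ e)
    IsInducedAlgebra Z ζ F λ′ α =
      (ζ ∘ α ≈ F₁ B α ∘ (η λ′ Z ∘ F₁ F ζ)) ×
      (∀ β → ζ ∘ β ≈ F₁ B β ∘ (η λ′ Z ∘ F₁ F ζ) → β ≈ α)

  record IsMonad (T : Endofunctor) (ηT : NatTrans IdF T)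
                 (μT : NatTrans (T ∘F T) T) : Set (o ⊔ e) where
    field
      unitˡ : ∀ X → η μT X ∘ F₁ T (η ηT X) ≈ id
      unitʳ : ∀ X → η μT X ∘ η ηT (F₀ T X) ≈ id
      mult-assoc : ∀ X → η μT X ∘ F₁ T (η μT X) ≈ η μT X ∘ η μT (F₀ T X)

  IsDistributiveLaw : (B T : Endofunctor) (ηT : NatTrans IdF T)
                      (μT : NatTrans (T ∘F T) T)
                      (τ : NatTrans (T ∘F B) (B ∘F T)) → Set (o ⊔ e)
  IsDistributiveLaw B T ηT μT τ =
    (∀ X → F₁ B (η ηT X) ≈ η τ X ∘ η ηT (F₀ B X)) ×
    (∀ X → η τ X ∘ η μT (F₀ B X) ≈
           F₁ B (η μT X) ∘ (η τ (F₀ T X) ∘ F₁ T (η τ X)))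

  IsInitial : Obj → Set (o ⊔ ℓ ⊔ e)
  IsInitial I = ∀ X → Σ (Hom I X) (λ _ → ∀ (f g : Hom I X) → f ≈ g)

-- A B-coalgebra ξ : X → BX is an object (Const X, ξ) of DL(B): the
-- constant functor with the constant distributive law.  DL-morphisms
-- (Const X, ξ) → (T, τ) correspond to coalgebra morphisms (X, ξ) → (T0, ζ):
-- a DL-morphism κ restricts to its component κ₀, and a coalgebra morphism f
-- extends to the DL-morphism with components T!_A ∘ f, whose component at 0
-- is f again.  Finality of (T, τ) in DL(B) therefore transfers to finality
-- of (T0, ζ).  For the second claim, a general fact about final coalgebras
-- says that any α satisfying the defining equation ζ ∘ α = Bα ∘ λ_Z ∘ Fζ is
-- the induced algebra (both are coalgebra morphisms out of the same
-- coalgebra); μ₀ satisfies that equation by naturality of μ and the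
-- multiplication axiom of the distributive law.
module Submission where

open import Defs
open import Level using (Level)
open import Data.Product using (Σ; _×_; proj₁; proj₂; _,_)
open import Relation.Binary using (IsEquivalence; Setoid)
import Relation.Binary.Reasoning.Setoid as SetoidReasoning

module _ {o ℓ e : Level} (C : Category o ℓ e) where
  open Category C
  open Endofunctor
  open NatTrans

  hom-setoid : Obj → Obj → Setoid ℓ e
  hom-setoid A B = record { Carrier = Hom A B ; _≈_ = _≈_ ; isEquivalence = ≈-equiv }

  module ≈ {A B : Obj} = IsEquivalence (≈-equiv {A} {B})
  module HomReasoning {A B : Obj} = SetoidReasoning (hom-setoid A B)
  open HomReasoning

  infixr 4 _⟩∘⟨refl refl⟩∘⟨_

  _⟩∘⟨refl : ∀ {A B D} {f g : Hom B D} {h : Hom A B} → f ≈ g → f ∘ h ≈ g ∘ h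
  p ⟩∘⟨refl = ∘-resp-≈ p ≈.refl

  refl⟩∘⟨_ : ∀ {A B D} {f : Hom B D} {g h : Hom A B} → g ≈ h → f ∘ g ≈ f ∘ h
  refl⟩∘⟨ p = ∘-resp-≈ ≈.refl p

  Const : Obj → Endofunctor C
  Const X = record
    { F₀ = λ _ → X ; F₁ = λ _ → id
    ; identity = ≈.refl ; homomorphism = ≈.sym identityˡ ; F-resp-≈ = λ _ → ≈.refl }

  const-law : (B : Endofunctor C) {X : Obj} → Hom X (F₀ B X) →
              NatTrans C (_∘F_ C (Const X) B) (_∘F_ C B (Const X))
  const-law B ξ = record
    { η = λ _ → ξ
    ; commute = λ _ → ≈.trans identityʳ
                        (≈.trans (≈.sym identityˡ) (≈.sym (identity B) ⟩∘⟨refl)) }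

  -- On a final coalgebra (Z, ζ), any α : FZ → Z satisfying the equation
  -- ζ ∘ α = Bα ∘ λ_Z ∘ Fζ is the algebra induced by λ: every solution is a
  -- coalgebra morphism out of (FZ, λ_Z ∘ Fζ), so all solutions coincide.
  induced-algebra-from-equation :
    (B : Endofunctor C) {Z : Obj} {ζ : Hom Z (F₀ B Z)} →
    IsFinalCoalgebra C B Z ζ →
    (F : Endofunctor C) (λ′ : NatTrans C (_∘F_ C F B) (_∘F_ C B F))
    (α : Hom (F₀ F Z) Z) →
    ζ ∘ α ≈ F₁ B α ∘ (η λ′ Z ∘ F₁ F ζ) →
    IsInducedAlgebra C B Z ζ F λ′ α
  induced-algebra-from-equation B {Z} {ζ} final F λ′ α α-eq =
    α-eq , λ β β-eq → proj₂ (final (F₀ F Z) (η λ′ Z ∘ F₁ F ζ)) β α β-eq α-eq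

  module CompanionCoalgebra (I : Obj) (initial : IsInitial C I)
                            (B T : Endofunctor C)
                            (τ : NatTrans C (_∘F_ C T B) (_∘F_ C B T)) where

    ! : ∀ A → Hom I A
    ! A = proj₁ (initial A)

    !-unique : ∀ {A} (f g : Hom I A) → f ≈ g
    !-unique {A} = proj₂ (initial A)

    ζ : Hom (F₀ T I) (F₀ B (F₀ T I))
    ζ = η τ I ∘ F₁ T (! (F₀ B I))

    T!-identity : F₁ T (! I) ≈ id
    T!-identity = ≈.trans (F-resp-≈ T (!-unique (! I) id)) (identity T)

    T!-absorb : ∀ {A A′} (g : Hom A A′) → F₁ T g ∘ F₁ T (! A) ≈ F₁ T (! A′)
    T!-absorb {A′ = A′} g =
      ≈.trans (≈.sym (homomorphism T)) (F-resp-≈ T (!-unique (g ∘ ! _) (! A′)))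

    module _ {X : Obj} (ξ : Hom X (F₀ B X)) where

      CoalgDL : DLObj C B
      CoalgDL = Const X , const-law B ξ

      component-is-coalgebra-morphism :
        (κ : DLMor C B CoalgDL (T , τ)) → IsCoalgMor C B ξ ζ (η (proj₁ κ) I)
      component-is-coalgebra-morphism (κ , κ-DL) = begin
        (η τ I ∘ F₁ T (! (F₀ B I))) ∘ η κ I  ≈⟨ assoc ⟩
        η τ I ∘ (F₁ T (! (F₀ B I)) ∘ η κ I)  ≈⟨ refl⟩∘⟨ ≈.sym (commute κ (! (F₀ B I))) ⟩
        η τ I ∘ (η κ (F₀ B I) ∘ id)          ≈⟨ refl⟩∘⟨ identityʳ ⟩
        η τ I ∘ η κ (F₀ B I)                 ≈⟨ κ-DL I ⟩
        F₁ B (η κ I) ∘ ξ                     ∎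

      extend : (f : Hom X (F₀ T I)) → IsCoalgMor C B ξ ζ f → DLMor C B CoalgDL (T , τ)
      extend f f-mor = κ , κ-DL
        where
        κ : NatTrans C (Const X) T
        κ = record
          { η = λ A → F₁ T (! A) ∘ f
          ; commute = λ {A} {A′} g → begin
              (F₁ T (! A′) ∘ f) ∘ id         ≈⟨ identityʳ ⟩
              F₁ T (! A′) ∘ f                ≈⟨ ≈.sym (T!-absorb g) ⟩∘⟨refl ⟩
              (F₁ T g ∘ F₁ T (! A)) ∘ f      ≈⟨ assoc ⟩
              F₁ T g ∘ (F₁ T (! A) ∘ f)      ∎ }

        κ-DL : IsDLMor C B CoalgDL (T , τ) κ
        κ-DL A = begin
          η τ A ∘ (F₁ T (! (F₀ B A)) ∘ f)
            ≈⟨ refl⟩∘⟨ (≈.sym (T!-absorb (F₁ B (! A))) ⟩∘⟨refl) ⟩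
          η τ A ∘ ((F₁ T (F₁ B (! A)) ∘ F₁ T (! (F₀ B I))) ∘ f)
            ≈⟨ refl⟩∘⟨ assoc ⟩
          η τ A ∘ (F₁ T (F₁ B (! A)) ∘ (F₁ T (! (F₀ B I)) ∘ f))
            ≈⟨ ≈.sym assoc ⟩
          (η τ A ∘ F₁ T (F₁ B (! A))) ∘ (F₁ T (! (F₀ B I)) ∘ f)
            ≈⟨ commute τ (! A) ⟩∘⟨refl ⟩
          (F₁ B (F₁ T (! A)) ∘ η τ I) ∘ (F₁ T (! (F₀ B I)) ∘ f)
            ≈⟨ assoc ⟩
          F₁ B (F₁ T (! A)) ∘ (η τ I ∘ (F₁ T (! (F₀ B I)) ∘ f))
            ≈⟨ refl⟩∘⟨ ≈.sym assoc ⟩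
          F₁ B (F₁ T (! A)) ∘ (ζ ∘ f)
            ≈⟨ refl⟩∘⟨ f-mor ⟩
          F₁ B (F₁ T (! A)) ∘ (F₁ B f ∘ ξ)
            ≈⟨ ≈.sym assoc ⟩
          (F₁ B (F₁ T (! A)) ∘ F₁ B f) ∘ ξ
            ≈⟨ ≈.sym (homomorphism B) ⟩∘⟨refl ⟩
          F₁ B (F₁ T (! A) ∘ f) ∘ ξ
            ∎

      extend-at-0 : (f : Hom X (F₀ T I)) (f-mor : IsCoalgMor C B ξ ζ f) →
                    η (proj₁ (extend f f-mor)) I ≈ f
      extend-at-0 f _ = ≈.trans (T!-identity ⟩∘⟨refl) identityˡ

    final-coalgebra : IsCompanion C B T τ → IsFinalCoalgebra C B (F₀ T I) ζ
    final-coalgebra (to-T , unique) X ξ = existence , uniqueness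
      where
      existence : Σ (Hom X (F₀ T I)) (IsCoalgMor C B ξ ζ)
      existence = η (proj₁ (to-T (CoalgDL ξ))) I
                , component-is-coalgebra-morphism ξ (to-T (CoalgDL ξ))

      uniqueness : ∀ f g → IsCoalgMor C B ξ ζ f → IsCoalgMor C B ξ ζ g → f ≈ g
      uniqueness f g f-mor g-mor = begin
        f                                     ≈⟨ extend-at-0 ξ f f-mor ⟨
        η (proj₁ (extend ξ f f-mor)) I        ≈⟨ unique (CoalgDL ξ) (extend ξ f f-mor) (extend ξ g g-mor) I ⟩
        η (proj₁ (extend ξ g g-mor)) I        ≈⟨ extend-at-0 ξ g g-mor ⟩
        g                                     ∎

    -- μ₀ satisfies the equation defining the algebra induced by τ on
    -- (T0, ζ): by naturality of μ and the multiplication axiom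
    -- τ ∘ μB = Bμ ∘ τT ∘ Tτ of the distributive law.
    μ-induced-equation :
      (ηT : NatTrans C (IdF C) T) (μT : NatTrans C (_∘F_ C T T) T) →
      IsDistributiveLaw C B T ηT μT τ →
      ζ ∘ η μT I ≈ F₁ B (η μT I) ∘ (η τ (F₀ T I) ∘ F₁ T ζ)
    μ-induced-equation ηT μT (_ , τ-μ) = begin
      (η τ I ∘ F₁ T (! (F₀ B I))) ∘ η μT I
        ≈⟨ assoc ⟩
      η τ I ∘ (F₁ T (! (F₀ B I)) ∘ η μT I)
        ≈⟨ refl⟩∘⟨ commute μT (! (F₀ B I)) ⟨
      η τ I ∘ (η μT (F₀ B I) ∘ F₁ T (F₁ T (! (F₀ B I))))
        ≈⟨ assoc ⟨
      (η τ I ∘ η μT (F₀ B I)) ∘ F₁ T (F₁ T (! (F₀ B I)))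
        ≈⟨ τ-μ I ⟩∘⟨refl ⟩
      (F₁ B (η μT I) ∘ (η τ (F₀ T I) ∘ F₁ T (η τ I))) ∘ F₁ T (F₁ T (! (F₀ B I)))
        ≈⟨ assoc ⟩
      F₁ B (η μT I) ∘ ((η τ (F₀ T I) ∘ F₁ T (η τ I)) ∘ F₁ T (F₁ T (! (F₀ B I))))
        ≈⟨ refl⟩∘⟨ assoc ⟩
      F₁ B (η μT I) ∘ (η τ (F₀ T I) ∘ (F₁ T (η τ I) ∘ F₁ T (F₁ T (! (F₀ B I)))))
        ≈⟨ refl⟩∘⟨ refl⟩∘⟨ homomorphism T ⟨
      F₁ B (η μT I) ∘ (η τ (F₀ T I) ∘ F₁ T ζ)
        ∎

theorem4p4 : ∀ {o ℓ e : Level} (C : Category o ℓ e) →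
    let open Category C in
    (I : Obj) (initial : IsInitial C I) →
    (B T : Endofunctor C) (τ : NatTrans C (_∘F_ C T B) (_∘F_ C B T)) →
    IsCompanion C B T τ →
    (ηT : NatTrans C (IdF C) T) (μT : NatTrans C (_∘F_ C T T) T) →
    IsMonad C T ηT μT →
    IsDistributiveLaw C B T ηT μT τ →
    IsFinalCoalgebra C B (Endofunctor.F₀ T I)
      (NatTrans.η τ I ∘ Endofunctor.F₁ T (proj₁ (initial (Endofunctor.F₀ B I))))
    ×
    IsInducedAlgebra C B (Endofunctor.F₀ T I)
      (NatTrans.η τ I ∘ Endofunctor.F₁ T (proj₁ (initial (Endofunctor.F₀ B I))))
      T τ (NatTrans.η μT I)
theorem4p4 C I initial B T τ companion ηT μT _ distributive =
  final , induced-algebra-from-equation C B final T τ (NatTrans.η μT I)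
            (μ-induced-equation ηT μT distributive)
  where
  open CompanionCoalgebra C I initial B T τ
  final : IsFinalCoalgebra C B (Endofunctor.F₀ T I) ζ
  final = final-coalgebra companion
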